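{- Let $p$ be a prime, $n\ge 2$, and let $L:\mathbb{F}_p^n\rightarrow\mathbb{F}_p^{n-1}$ be the linear map $L(x_1,\ldots,x_n)=(x_1+x_n,x_2+x_n,\ldots,x_{n-1}+x_n)$. Let $S_1,\ldots,S_n\subseteq\mathbb{F}_p$ be nonempty sets with $|S_i|=s_i$ such that $\min_i(s_i)+\max_i(s_i)\le p+1$. Then $$|L(S_1,\ldots,S_n)|\ \ge\ \prod_{i=1}^n s_i-\prod_{i=1}^n(s_i-1).$$
   Context: $L(S_1,\ldots,S_n)$ denotes the image of $S_1\times\cdots\times S_n$ under $L$. -}

module Defs where

open import Data.Nat using (ℕ; zero; suc; _*_; NonZero)
import Data.Nat as ℕ
open import Data.Nat.DivMod using (_mod_)
open import Data.Fin using (Fin; toℕ; _≟_)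
open import Data.Fin.Subset using (Subset)
open import Data.Fin.Subset.Properties using (_∈?_)
open import Data.Vec using (Vec; []; _∷_; init; last; foldr)
import Data.Vec as Vec
open import Data.Vec.Properties using (≡-dec)
open import Data.List using (List; []; _∷_; length; filter; allFin; cartesianProductWith; deduplicate)
import Data.List as List

_+ₚ_ : ∀ {p} .{{_ : NonZero p}} → Fin p → Fin p → Fin p
_+ₚ_ {p} a b = (toℕ a ℕ.+ toℕ b) mod p

-- L(x_1,…,x_n) = (x_1 + x_n, …, x_{n-1} + x_n), with n = suc m.
L : ∀ {p m} .{{_ : NonZero p}} → Vec (Fin p) (suc m) → Vec (Fin p) m
L x = Vec.map (λ y → y +ₚ last x) (init x)

elems : ∀ {p} → Subset p → List (Fin p)
elems {p} S = filter (_∈? S) (allFin p)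

choices : ∀ {p n} → Vec (Subset p) n → List (Vec (Fin p) n)
choices [] = [] ∷ []
choices (S ∷ Ss) = cartesianProductWith _∷_ (elems S) (choices Ss)

imageSize : ∀ {p m} .{{_ : NonZero p}} → Vec (Subset p) (suc m) → ℕ
imageSize Ss = length (deduplicate (≡-dec _≟_) (List.map L (choices Ss)))

prodV : ∀ {n} → Vec ℕ n → ℕ
prodV = foldr _ _*_ 1

-- An element y lies in L(S₁, …, Sₙ) iff some t ∈ Sₙ has yᵢ − t ∈ Sᵢ for all i < n; call the set of
-- such t the fibre of y. Splitting off the first coordinate, |L(S₁, …, Sₙ)| is the sum, over the
-- remaining coordinates, of |S₁ + F| for the fibres F ⊆ Sₙ of L(S₂, …, Sₙ). By Cauchy–Davenport
-- (Dyson's e-transform; primality enters only as "nonzero elements have order p"),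
-- |S₁ + F| ≥ s₁ − 1 + |F| for nonempty F provided s₁ + sₙ ≤ p + 1. Hence
-- |L(S₁, …, Sₙ)| ≥ (s₁ − 1)·|L(S₂, …, Sₙ)| + s₂⋯sₙ, which telescopes to the bound. The proviso holds
-- when sₙ is the smallest size; in general the change of variables (yᵢ)ᵢ ↦ (yᵢ − yⱼ)_{i≠j} with
-- −yⱼ in slot j replaces (Sⱼ, Sₙ) by (−Sₙ, −Sⱼ) without shrinking the image.

module Submission where

open import Defs using (_+ₚ_; L; elems; choices; imageSize; prodV)

open import Algebra.Bundles using (AbelianGroup)
open import Algebra.Core using (Op₁; Op₂)
import Algebra.Properties.AbelianGroup as AbelianGroupProperties
import Algebra.Properties.CommutativeSemigroup as CommutativeSemigroupProperties
import Algebra.Properties.Monoid.Mult as MonoidMultiplication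
open import Algebra.Structures using (IsAbelianGroup)
open import Level using (0ℓ)
open import Data.Bool using (Bool; true; false; _∧_; _∨_; not; T)
open import Data.Bool.Properties using (∧-zeroʳ; ∧-identityʳ; ∧-comm; T-≡; T-∧; T-∨)
open import Data.Empty using (⊥-elim)
open import Data.Fin using (Fin; zero; suc; toℕ; inject₁; fromℕ)
import Data.Fin as Fin
open import Data.Fin.Properties using (toℕ-injective; toℕ<n; toℕ-fromℕ<)
open import Data.Fin.Subset using (Subset; ∣_∣)
open import Data.Fin.Subset.Properties using () renaming (_∈?_ to _∈ₛ?_)
open import Data.List using (List; []; _∷_; _++_; map; filter; length; cartesianProductWith; allFin; deduplicate)
import Data.List as List
open import Data.List.Relation.Unary.Unique.DecPropositional.Properties using (deduplicate-!)
open import Data.Bool.ListAction using (any)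
open import Data.List.Membership.Propositional using (_∈_; lose)
open import Data.List.Membership.Propositional.Properties
  using (∈-filter⁺; ∈-filter⁻; ∈-map⁺; ∈-map⁻; ∈-cartesianProductWith⁺; ∈-cartesianProductWith⁻; ∈-allFin
        ; ∈-deduplicate⁺; ∈-deduplicate⁻)
open import Data.List.Membership.Propositional.Properties.WithK using (unique∧set⇒bag)
open import Data.List.Properties using (map-cong; map-++; map-∘; map-tabulate; length-map; length-tabulate)
open import Data.List.Relation.Binary.BagAndSetEquality using (∼bag⇒↭)
open import Data.List.Relation.Binary.Permutation.Propositional using (_↭_)
open import Data.List.Relation.Binary.Permutation.Propositional.Properties using (↭-length)
import Data.List.Relation.Binary.Permutation.Propositional.Properties as ↭
import Data.List.Relation.Unary.All as All
import Data.List.Relation.Unary.AllPairs as AllPairs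
open import Data.List.Relation.Unary.Any using (here; satisfied)
open import Data.List.Relation.Unary.Any.Properties using (any⁺; any⁻)
open import Data.List.Relation.Unary.Unique.Propositional using (Unique)
import Data.List.Relation.Unary.Unique.Propositional.Properties as Unique
open import Data.Nat
  using (ℕ; zero; suc; _+_; _*_; _∸_; _%_; _⊓_; _⊔_; _≤_; _≥_; _<_; z≤n; s≤s; s≤s⁻¹; _≤?_; pred
        ; NonZero; >-nonZero; >-nonZero⁻¹)
open import Data.Nat.DivMod using (_mod_; %-distribˡ-+; m<n⇒m%n≡m; n%n≡0)
open import Data.Nat.Divisibility using (_∣_; m%n≡0⇒n∣m; n∣m⇒m%n≡0)
open import Data.Nat.Primality using (Prime; euclidsLemma)
open import Data.Nat.Tactic.RingSolver using (solve-∀)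
open import Data.Nat.ListAction using (sum)
open import Data.Nat.ListAction.Properties using (sum-++; sum-↭)
open import Data.Nat.Properties
open import Data.Sum using (_⊎_; inj₁; inj₂)
open import Data.Product using (∃; ∃₂; _×_; _,_; proj₁; proj₂)
open import Data.Vec using (Vec; []; _∷_; lookup; _[_]≔_; init; last; foldr₁)
import Data.Vec as Vec
import Data.Vec.Properties as VecProperties
open import Data.Vec.Properties
  using (∷-injective; ≡-dec; lookup-map; lookup∘update; lookup∘update′; map-[]≔; lookup⇒[]=; []=⇒lookup)
open import Data.Vec.Relation.Binary.Pointwise.Extensional using (ext; Pointwise-≡⇒≡)
open import Function.Base using (_∘_; id)
open import Function.Bundles using (mk⇔; Equivalence)
open import Relation.Binary.Definitions using (DecidableEquality)
open import Relation.Unary using (Decidable)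
open import Relation.Binary.PropositionalEquality
open import Relation.Nullary using (¬_; yes; no)
open import Relation.Nullary.Decidable using (⌊_⌋; toWitness; fromWitness)

-- Booleans, indicators and finite sums

T-∧-not : ∀ {a b} → T (a ∧ not b) → T a × ¬ T b
T-∧-not {true} {false} _ = _ , λ ()

¬T-∧-not : ∀ {a b} → ¬ T (a ∧ not b) → T a → T b
¬T-∧-not {true} {true} _ _ = _
¬T-∧-not {true} {false} ¬a∧¬b _ = ¬a∧¬b _

T-ext : ∀ {a b} → (T a → T b) → (T b → T a) → a ≡ b
T-ext {false} {false} _ _ = refl
T-ext {false} {true} _ b⇒a = ⊥-elim (b⇒a _)
T-ext {true} {false} a⇒b _ = ⊥-elim (a⇒b _)
T-ext {true} {true} _ _ = refl

𝟙 : Bool → ℕ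
𝟙 true = 1
𝟙 false = 0

𝟙-mono : ∀ {a b} → (T a → T b) → 𝟙 a ≤ 𝟙 b
𝟙-mono {false} _ = z≤n
𝟙-mono {true} {true} _ = ≤-refl
𝟙-mono {true} {false} a⇒b = ⊥-elim (a⇒b _)

𝟙-∧ : ∀ a b → 𝟙 (a ∧ b) ≡ 𝟙 a * 𝟙 b
𝟙-∧ true b = sym (+-identityʳ (𝟙 b))
𝟙-∧ false b = refl

𝟙-∨-∧ : ∀ a b → 𝟙 (a ∨ b) + 𝟙 (a ∧ b) ≡ 𝟙 a + 𝟙 b
𝟙-∨-∧ true true = refl
𝟙-∨-∧ true false = refl
𝟙-∨-∧ false b = +-comm (𝟙 b) 0

𝟙-split : ∀ a b → 𝟙 a ≡ 𝟙 (a ∧ b) + 𝟙 (a ∧ not b)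
𝟙-split true true = refl
𝟙-split true false = refl
𝟙-split false b = refl

module _ {A : Set} where

  ∑ : List A → (A → ℕ) → ℕ
  ∑ xs f = sum (map f xs)

  ∑-cong : ∀ xs {f g : A → ℕ} → (∀ x → f x ≡ g x) → ∑ xs f ≡ ∑ xs g
  ∑-cong xs f≗g = cong sum (map-cong f≗g xs)

  ∑-zero : ∀ xs → ∑ xs (λ _ → 0) ≡ 0
  ∑-zero [] = refl
  ∑-zero (_ ∷ xs) = ∑-zero xs

  ∑-mono : ∀ xs {f g : A → ℕ} → (∀ x → f x ≤ g x) → ∑ xs f ≤ ∑ xs g
  ∑-mono [] f≤g = z≤n
  ∑-mono (x ∷ xs) f≤g = +-mono-≤ (f≤g x) (∑-mono xs f≤g)

  ∑-distrib-+ : ∀ xs (f g : A → ℕ) → ∑ xs (λ x → f x + g x) ≡ ∑ xs f + ∑ xs g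
  ∑-distrib-+ [] f g = refl
  ∑-distrib-+ (x ∷ xs) f g =
    trans (cong (f x + g x +_) (∑-distrib-+ xs f g))
          (CommutativeSemigroupProperties.interchange +-commutativeSemigroup (f x) (g x) _ _)

  ∑-*ˡ : ∀ xs c (f : A → ℕ) → ∑ xs (λ x → c * f x) ≡ c * ∑ xs f
  ∑-*ˡ [] c f = sym (*-zeroʳ c)
  ∑-*ˡ (x ∷ xs) c f = trans (cong (c * f x +_) (∑-*ˡ xs c f)) (sym (*-distribˡ-+ c (f x) _))

  ∑-*ʳ : ∀ xs c (f : A → ℕ) → ∑ xs (λ x → f x * c) ≡ ∑ xs f * c
  ∑-*ʳ xs c f = trans (∑-cong xs (λ x → *-comm (f x) c)) (trans (∑-*ˡ xs c f) (*-comm c _))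

  ∑-↭ : ∀ {xs ys} (f : A → ℕ) → xs ↭ ys → ∑ xs f ≡ ∑ ys f
  ∑-↭ f xs↭ys = sum-↭ (↭.map⁺ f xs↭ys)

  ∑-++ : ∀ xs ys (f : A → ℕ) → ∑ (xs ++ ys) f ≡ ∑ xs f + ∑ ys f
  ∑-++ xs ys f = trans (cong sum (map-++ f xs ys)) (sum-++ (map f xs) (map f ys))

  ∑-𝟙-filter : ∀ {P : A → Set} (P? : Decidable P) xs → ∑ xs (λ x → 𝟙 ⌊ P? x ⌋) ≡ length (filter P? xs)
  ∑-𝟙-filter P? [] = refl
  ∑-𝟙-filter P? (x ∷ xs) with P? x
  ... | yes _ = cong suc (∑-𝟙-filter P? xs)
  ... | no _ = ∑-𝟙-filter P? xs

  ∑-pos : ∀ xs (P : A → Bool) → 1 ≤ ∑ xs (𝟙 ∘ P) → ∃ λ x → T (P x)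
  ∑-pos (x ∷ xs) P pos with P x in Px
  ... | true = x , subst T (sym Px) _
  ... | false = ∑-pos xs P pos

∑-allFin-suc : ∀ {n} (f : Fin (suc n) → ℕ) → ∑ (allFin (suc n)) f ≡ f zero + ∑ (allFin n) (f ∘ suc)
∑-allFin-suc f = cong (λ xs → f zero + sum xs) (trans (map-tabulate suc f) (sym (map-tabulate id (f ∘ suc))))

∑-map : ∀ {A B : Set} xs (g : A → B) (f : B → ℕ) → ∑ (map g xs) f ≡ ∑ xs (f ∘ g)
∑-map xs g f = cong sum (sym (map-∘ xs))

module _ {A B : Set} where

  ∑-comm : ∀ xs ys (f : A → B → ℕ) → ∑ xs (λ x → ∑ ys (f x)) ≡ ∑ ys (λ y → ∑ xs (λ x → f x y))
  ∑-comm [] ys f = sym (∑-zero ys)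
  ∑-comm (x ∷ xs) ys f =
    trans (cong (∑ ys (f x) +_) (∑-comm xs ys f)) (sym (∑-distrib-+ ys (f x) _))

  ∑-cartesianProductWith : ∀ {C : Set} (g : A → B → C) xs ys (f : C → ℕ) →
    ∑ (cartesianProductWith g xs ys) f ≡ ∑ xs (λ x → ∑ ys (f ∘ g x))
  ∑-cartesianProductWith g [] ys f = refl
  ∑-cartesianProductWith g (x ∷ xs) ys f =
    trans (∑-++ (map (g x) ys) _ f)
          (cong₂ _+_ (∑-map ys (g x) f) (∑-cartesianProductWith g xs ys f))

module _ {A : Set} where

  lookup-init : ∀ {m} (xs : Vec A (suc m)) i → lookup (init xs) i ≡ lookup xs (inject₁ i)
  lookup-init (x ∷ _ ∷ _) zero = refl
  lookup-init (x ∷ xs@(_ ∷ _)) (suc i) = lookup-init xs i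

  lookup-last : ∀ {m} (xs : Vec A (suc m)) → last xs ≡ lookup xs (fromℕ m)
  lookup-last (x ∷ []) = refl
  lookup-last (x ∷ xs@(_ ∷ _)) = lookup-last xs

  lookup-init-last : ∀ {m} (xs : Vec A (suc m)) i → lookup xs i ≡ last xs ⊎ ∃ λ j → lookup xs i ≡ lookup (init xs) j
  lookup-init-last (x ∷ []) zero = inj₁ refl
  lookup-init-last (x ∷ _ ∷ _) zero = inj₂ (zero , refl)
  lookup-init-last (x ∷ xs@(_ ∷ _)) (suc i) with lookup-init-last xs i
  ... | inj₁ xᵢ≡last = inj₁ xᵢ≡last
  ... | inj₂ (j , xᵢ≡) = inj₂ (suc j , xᵢ≡)

  prodV-map-init-last : ∀ {m} (f : A → ℕ) (xs : Vec A (suc m)) →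
                        prodV (Vec.map f xs) ≡ prodV (Vec.map f (init xs)) * f (last xs)
  prodV-map-init-last f (x ∷ []) = *-comm (f x) 1
  prodV-map-init-last f (x ∷ xs@(_ ∷ _)) =
    trans (cong (f x *_) (prodV-map-init-last f xs)) (sym (*-assoc (f x) _ _))

foldr₁-⊓-attained : ∀ {n} (v : Vec ℕ (suc n)) → ∃ λ i → lookup v i ≡ foldr₁ _⊓_ v
foldr₁-⊓-attained (x ∷ []) = zero , refl
foldr₁-⊓-attained (x ∷ v@(_ ∷ _)) with ⊓-sel x (foldr₁ _⊓_ v)
... | inj₁ x⊓≡x = zero , sym x⊓≡x
... | inj₂ x⊓≡min with foldr₁-⊓-attained v
...   | i , vᵢ≡min = suc i , trans vᵢ≡min (sym x⊓≡min)

≤-foldr₁-⊔ : ∀ {n} (v : Vec ℕ (suc n)) i → lookup v i ≤ foldr₁ _⊔_ v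
≤-foldr₁-⊔ (x ∷ []) zero = ≤-refl
≤-foldr₁-⊔ (x ∷ _ ∷ _) zero = m≤m⊔n x _
≤-foldr₁-⊔ (x ∷ v@(_ ∷ _)) (suc i) = ≤-trans (≤-foldr₁-⊔ v i) (m≤n⊔m x _)

prodV-[]≔ : ∀ {m} (v : Vec ℕ m) j a → prodV (v [ j ]≔ a) * lookup v j ≡ prodV v * a
prodV-[]≔ (x ∷ v) zero a = begin
  a * prodV v * x    ≡⟨ *-assoc a _ x ⟩
  a * (prodV v * x)  ≡⟨ cong (a *_) (*-comm _ x) ⟩
  a * (x * prodV v)  ≡⟨ *-comm a _ ⟩
  x * prodV v * a    ∎
  where open ≡-Reasoning
prodV-[]≔ (x ∷ v) (suc j) a =
  trans (*-assoc x _ _) (trans (cong (x *_) (prodV-[]≔ v j a)) (sym (*-assoc x _ a)))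

-- Counting in enumerated types

unique-same-members⇒↭ : ∀ {A : Set} {xs ys : List A} → Unique xs → Unique ys →
                        (∀ {x} → x ∈ xs → x ∈ ys) → (∀ {x} → x ∈ ys → x ∈ xs) → xs ↭ ys
unique-same-members⇒↭ xs! ys! xs⊆ys ys⊆xs = ∼bag⇒↭ (unique∧set⇒bag xs! ys! (mk⇔ xs⊆ys ys⊆xs))

record Enumeration (A : Set) : Set where
  field
    elements : List A
    unique   : Unique elements
    complete : ∀ x → x ∈ elements

allFin-enumeration : ∀ n → Enumeration (Fin n)
allFin-enumeration n = record { elements = allFin n ; unique = Unique.allFin⁺ n ; complete = ∈-allFin }

vectors : ∀ {A} → Enumeration A → ∀ k → Enumeration (Vec A k)
vectors E zero = record
  { elements = [] ∷ []
  ; unique   = All.[] AllPairs.∷ AllPairs.[]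
  ; complete = λ { [] → here refl }
  }
vectors E (suc k) = record
  { elements = cartesianProductWith _∷_ elements (Enumeration.elements (vectors E k))
  ; unique   = Unique.cartesianProductWith⁺ _∷_ ∷-injective unique (Enumeration.unique (vectors E k))
  ; complete = λ { (x ∷ xs) → ∈-cartesianProductWith⁺ _∷_ (complete x) (Enumeration.complete (vectors E k) xs) }
  }
  where open Enumeration E

module Counting {A : Set} (_≟_ : DecidableEquality A) (E : Enumeration A) where
  open Enumeration E
  open import Data.List.Membership.DecPropositional _≟_ using (_∈?_)

  ∑-reindex : (f g : A → A) → (∀ x → g (f x) ≡ x) → (∀ x → f (g x) ≡ x) →
              (h : A → ℕ) → ∑ elements (h ∘ f) ≡ ∑ elements h
  ∑-reindex f g gf fg h = trans (sym (∑-map elements f h))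
    (∑-↭ h (unique-same-members⇒↭ unique-f unique (λ _ → complete _) (λ {x} _ → f-onto x)))
    where
    unique-f : Unique (map f elements)
    unique-f = Unique.map⁺ (λ {x} {y} fx≡fy → trans (sym (gf x)) (trans (cong g fx≡fy) (gf y))) unique
    f-onto : ∀ x → x ∈ map f elements
    f-onto x = subst (_∈ map f elements) (fg x) (∈-map⁺ f (complete (g x)))

  card : (A → Bool) → ℕ
  card P = ∑ elements (𝟙 ∘ P)

  card-reindex : ∀ P (f g : A → A) → (∀ x → g (f x) ≡ x) → (∀ x → f (g x) ≡ x) → card (P ∘ f) ≡ card P
  card-reindex P f g gf fg = ∑-reindex f g gf fg (𝟙 ∘ P)

  card-mono : ∀ {P Q} → (∀ x → T (P x) → T (Q x)) → card P ≤ card Q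
  card-mono P⊆Q = ∑-mono elements (λ x → 𝟙-mono (P⊆Q x))

  card-∨-∧ : ∀ P Q → card (λ x → P x ∨ Q x) + card (λ x → P x ∧ Q x) ≡ card P + card Q
  card-∨-∧ P Q = trans (sym (∑-distrib-+ elements _ _))
    (trans (∑-cong elements (λ x → 𝟙-∨-∧ (P x) (Q x))) (∑-distrib-+ elements _ _))

  card-∈ : ∀ {u} → Unique u → card (λ x → ⌊ x ∈? u ⌋) ≡ length u
  card-∈ {u} u! = trans (∑-𝟙-filter (_∈? u) elements) (↭-length (unique-same-members⇒↭
    (Unique.filter⁺ (_∈? u) unique) u!
    (λ x∈ → proj₂ (∈-filter⁻ (_∈? u) {xs = elements} x∈)) (λ x∈u → ∈-filter⁺ (_∈? u) (complete _) x∈u)))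

  card-≟ : ∀ b → card (λ x → ⌊ x ≟ b ⌋) ≡ 1
  card-≟ b = trans (∑-cong elements (cong 𝟙 ∘ ≟⇒∈?)) (card-∈ {b ∷ []} (All.[] AllPairs.∷ AllPairs.[]))
    where
    ≟⇒∈? : ∀ x → ⌊ x ≟ b ⌋ ≡ ⌊ x ∈? b ∷ [] ⌋
    ≟⇒∈? x with x ≟ b
    ... | yes _ = refl
    ... | no _ = refl

  _─_ : (A → Bool) → A → A → Bool
  (P ─ b) x = P x ∧ not ⌊ x ≟ b ⌋

  T-─ : ∀ {P b x} → T ((P ─ b) x) → T (P x) × x ≢ b
  T-─ {P} {b} {x} h with x ≟ b
  ... | yes _ = ⊥-elim (subst T (∧-zeroʳ (P x)) h)
  ... | no x≢b = subst T (∧-identityʳ (P x)) h , x≢b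

  T-─⁺ : ∀ {P b x} → T (P x) → x ≢ b → T ((P ─ b) x)
  T-─⁺ {P} {b} {x} Px x≢b with x ≟ b
  ... | yes x≡b = ⊥-elim (x≢b x≡b)
  ... | no _ = subst T (sym (∧-identityʳ (P x))) Px

  card-─ : ∀ P b → card P ≡ 𝟙 (P b) + card (P ─ b)
  card-─ P b = begin
    card P                                                 ≡⟨ ∑-cong elements (λ x → 𝟙-split (P x) ⌊ x ≟ b ⌋) ⟩
    ∑ elements (λ x → 𝟙 (P x ∧ ⌊ x ≟ b ⌋) + 𝟙 ((P ─ b) x)) ≡⟨ ∑-distrib-+ elements _ _ ⟩
    card (λ x → P x ∧ ⌊ x ≟ b ⌋) + card (P ─ b)            ≡⟨ cong (_+ card (P ─ b)) at-b ⟩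
    𝟙 (P b) + card (P ─ b)                                 ∎
    where
    open ≡-Reasoning
    only-b : ∀ x → 𝟙 (P x ∧ ⌊ x ≟ b ⌋) ≡ 𝟙 (P b) * 𝟙 ⌊ x ≟ b ⌋
    only-b x with x ≟ b
    ... | yes refl = 𝟙-∧ (P x) true
    ... | no _ = trans (cong 𝟙 (∧-zeroʳ (P x))) (sym (*-zeroʳ (𝟙 (P b))))
    at-b : card (λ x → P x ∧ ⌊ x ≟ b ⌋) ≡ 𝟙 (P b)
    at-b = trans (∑-cong elements only-b)
                 (trans (∑-*ˡ elements (𝟙 (P b)) _) (trans (cong (𝟙 (P b) *_) (card-≟ b)) (*-identityʳ _)))

  nonempty : ∀ {P} → 1 ≤ card P → ∃ λ x → T (P x)
  nonempty {P} = ∑-pos elements P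

  card-witness : ∀ P {b} → T (P b) → 1 ≤ card P
  card-witness P {b} Pb rewrite card-─ P b | T-≡ .Equivalence.to Pb = s≤s z≤n

  card-< : ∀ {P Q b} → (∀ x → T (P x) → T (Q x)) → ¬ T (P b) → T (Q b) → card P < card Q
  card-< {P} {Q} {b} P⊆Q ¬Pb Qb rewrite card-─ Q b | T-≡ .Equivalence.to Qb =
    s≤s (card-mono λ x Px → T-─⁺ {Q} (P⊆Q x Px) λ { refl → ¬Pb Px })

  two-distinct : ∀ P → 2 ≤ card P → ∃₂ λ x y → T (P x) × T (P y) × x ≢ y
  two-distinct P 2≤ with nonempty {P} (≤-trans (s≤s z≤n) 2≤)
  ... | x , Px with nonempty {P ─ x} (s≤s⁻¹ (subst (2 ≤_) card-P 2≤))
    where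
    card-P : card P ≡ 1 + card (P ─ x)
    card-P = trans (card-─ P x) (cong (λ b → 𝟙 b + card (P ─ x)) (T-≡ .Equivalence.to Px))
  ...   | y , Py─x with T-─ {P} Py─x
  ...     | Py , y≢x = x , y , Px , Py , λ x≡y → y≢x (sym x≡y)

  ∃? : ∀ P → (∃ λ x → T (P x)) ⊎ (∀ x → ¬ T (P x))
  ∃? P with 1 ≤? card P
  ... | yes 1≤card = inj₁ (nonempty 1≤card)
  ... | no 1≰card = inj₂ λ x Px → 1≰card (card-witness P Px)

  some : (A → Bool) → Bool
  some P = any P elements

  some-intro : ∀ P {x} → T (P x) → T (some P)
  some-intro P {x} Px = any⁺ P (lose (complete x) Px)

  some-elim : ∀ P → T (some P) → ∃ λ x → T (P x)
  some-elim P h = satisfied (any⁻ P elements h)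

  card-none : ∀ P → ¬ T (some P) → card P ≡ 0
  card-none P ¬some = n≤0⇒n≡0 (≤-trans (card-mono {Q = λ _ → false} (λ x Px → ¬some (some-intro P Px)))
                                      (≤-reflexive (∑-zero elements)))

-- Sumsets in a finite abelian group

module Sumsets
  {G : Set} {_∙_ : Op₂ G} {ε : G} {_⁻¹ : Op₁ G}
  (isAbelianGroup : IsAbelianGroup _≡_ _∙_ ε _⁻¹)
  (_≟_ : DecidableEquality G) (E : Enumeration G)
  where

  abelianGroup : AbelianGroup 0ℓ 0ℓ
  abelianGroup = record { isAbelianGroup = isAbelianGroup }

  open IsAbelianGroup isAbelianGroup public using (_-_)
  open IsAbelianGroup isAbelianGroup using (assoc; comm; identityˡ; identityʳ; inverseʳ)
  open AbelianGroupProperties abelianGroup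
    using ( //-rightDividesˡ; //-rightDividesʳ; ∙-cancelˡ; x∙y⁻¹≈ε⇒x≈y
          ; ⁻¹-involutive; ⁻¹-anti-homo-∙; ⁻¹-anti-homo‿-)
  open CommutativeSemigroupProperties (AbelianGroup.commutativeSemigroup abelianGroup)
    using (x∙yz≈y∙xz; x∙yz≈xz∙y)
  open MonoidMultiplication (AbelianGroup.monoid abelianGroup) using (×-homo-+) renaming (_×_ to _·_)
  open import Data.List.Membership.DecPropositional _≟_ using (_∈?_)
  open Enumeration E using (elements)
  open Counting _≟_ E public

  [x-y]∙y≡x : ∀ x y → (x - y) ∙ y ≡ x
  [x-y]∙y≡x x y = //-rightDividesˡ y x

  [x∙y]-y≡x : ∀ x y → (x ∙ y) - y ≡ x
  [x∙y]-y≡x x y = //-rightDividesʳ y x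

  y∙[x-y]≡x : ∀ x y → y ∙ (x - y) ≡ x
  y∙[x-y]≡x x y = trans (comm y (x - y)) ([x-y]∙y≡x x y)

  card-translate : ∀ P c → card (λ x → P (x - c)) ≡ card P
  card-translate P c = card-reindex P (_- c) (_∙ c) (λ x → [x-y]∙y≡x x c) (λ x → [x∙y]-y≡x x c)

  _⊕_ : (G → Bool) → (G → Bool) → G → Bool
  (A ⊕ B) y = some (λ t → B t ∧ A (y - t))

  ⊕-intro : ∀ A B {y} t → T (B t) → T (A (y - t)) → T ((A ⊕ B) y)
  ⊕-intro A B t Bt At = some-intro _ (T-∧ .Equivalence.from (Bt , At))

  ⊕-elim : ∀ A B {y} → T ((A ⊕ B) y) → ∃ λ t → T (B t) × T (A (y - t))
  ⊕-elim A B h with some-elim _ h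
  ... | t , h′ = t , T-∧ .Equivalence.to h′

  card-≤-⊕ : ∀ A B {b} → T (B b) → card A ≤ card (A ⊕ B)
  card-≤-⊕ A B {b} Bb = subst (_≤ card (A ⊕ B)) (card-translate A b)
    (card-mono λ y A[y-b] → ⊕-intro A B b Bb A[y-b])

  x≡z∙y⇒x-y≡z : ∀ {x y z} → x ≡ z ∙ y → x - y ≡ z
  x≡z∙y⇒x-y≡z {y = y} {z} refl = [x∙y]-y≡x z y

  y-[[y-t]-e]≡t∙e : ∀ y t e → y - ((y - t) - e) ≡ t ∙ e
  y-[[y-t]-e]≡t∙e y t e = x≡z∙y⇒x-y≡z (begin
    y                            ≡⟨ sym (y∙[x-y]≡x y t) ⟩
    t ∙ (y - t)                  ≡⟨ cong (t ∙_) (sym (y∙[x-y]≡x (y - t) e)) ⟩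
    t ∙ (e ∙ ((y - t) - e))      ≡⟨ sym (assoc t e _) ⟩
    (t ∙ e) ∙ ((y - t) - e)      ∎)
    where open ≡-Reasoning

  module DysonTransform (A B : G → Bool) (e : G) where

    A′ B′ : G → Bool
    A′ x = A x ∨ B (x - e)
    B′ x = B x ∧ A (x ∙ e)

    card-A′+B′ : card A′ + card B′ ≡ card A + card B
    card-A′+B′ = begin
      card A′ + card B′                        ≡⟨ cong (card A′ +_) (sym (card-translate B′ e)) ⟩
      card A′ + card (λ x → B′ (x - e))        ≡⟨ cong (card A′ +_) (∑-cong elements (cong 𝟙 ∘ B′[x-e])) ⟩
      card A′ + card (λ x → A x ∧ B (x - e))   ≡⟨ card-∨-∧ A (λ x → B (x - e)) ⟩
      card A + card (λ x → B (x - e))          ≡⟨ cong (card A +_) (card-translate B e) ⟩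
      card A + card B                          ∎
      where
      open ≡-Reasoning
      B′[x-e] : ∀ x → B′ (x - e) ≡ A x ∧ B (x - e)
      B′[x-e] x = trans (cong (λ z → B (x - e) ∧ A z) ([x-y]∙y≡x x e)) (∧-comm (B (x - e)) (A x))

    A⊆A′ : ∀ x → T (A x) → T (A′ x)
    A⊆A′ x Ax = T-∨ .Equivalence.from (inj₁ Ax)

    B′⊆B : ∀ x → T (B′ x) → T (B x)
    B′⊆B x B′x = proj₁ (T-∧ .Equivalence.to B′x)

    A′⊕B′⊆A⊕B : ∀ y → T ((A′ ⊕ B′) y) → T ((A ⊕ B) y)
    A′⊕B′⊆A⊕B y h with ⊕-elim A′ B′ h
    ... | t , B′t , A′[y-t] with T-∧ .Equivalence.to B′t | T-∨ .Equivalence.to A′[y-t]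
    ...   | Bt , _ | inj₁ A[y-t] = ⊕-intro A B t Bt A[y-t]
    ...   | _ , A[t∙e] | inj₂ B[y-t-e] =
            ⊕-intro A B ((y - t) - e) B[y-t-e] (subst (T ∘ A) (sym (y-[[y-t]-e]≡t∙e y t e)) A[t∙e])

  -- The possible last coordinates t of the preimages of y under (x, t) ↦ (xᵢ + t)ᵢ with xᵢ ∈ Xᵢ, t ∈ U.
  fiber : ∀ {k} → Vec (G → Bool) k → (G → Bool) → Vec G k → G → Bool
  fiber [] U [] = U
  fiber (X ∷ Xs) U (y ∷ ys) t = fiber Xs U ys t ∧ X (y - t)

  image : ∀ {k} → Vec (G → Bool) k → (G → Bool) → Vec G k → Bool
  image Xs U y = some (fiber Xs U y)

  vecs : ∀ k → List (Vec G k)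
  vecs = Enumeration.elements ∘ vectors E

  #image : ∀ {k} → Vec (G → Bool) k → (G → Bool) → ℕ
  #image {k} Xs U = ∑ (vecs k) (𝟙 ∘ image Xs U)

  ∏card ∏card⁻ : ∀ {k} → Vec (G → Bool) k → ℕ
  ∏card Xs = prodV (Vec.map card Xs)
  ∏card⁻ Xs = prodV (Vec.map (pred ∘ card) Xs)

  fiber⊆U : ∀ {k} (Xs : Vec (G → Bool) k) U ys t → T (fiber Xs U ys t) → T (U t)
  fiber⊆U [] U [] t Ut = Ut
  fiber⊆U (X ∷ Xs) U (y ∷ ys) t h = fiber⊆U Xs U ys t (proj₁ (T-∧ .Equivalence.to h))

  ∑-fiber : ∀ {k} (Xs : Vec (G → Bool) k) U t → ∑ (vecs k) (λ ys → 𝟙 (fiber Xs U ys t)) ≡ 𝟙 (U t) * ∏card Xs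
  ∑-fiber [] U t = trans (+-identityʳ _) (sym (*-identityʳ _))
  ∑-fiber {suc k} (X ∷ Xs) U t = begin
    ∑ (vecs (suc k)) (λ ys → 𝟙 (fiber (X ∷ Xs) U ys t))
      ≡⟨ ∑-cartesianProductWith _∷_ elements (vecs k) _ ⟩
    ∑ elements (λ y → ∑ (vecs k) (λ ys → 𝟙 (fiber Xs U ys t ∧ X (y - t))))
      ≡⟨ ∑-cong elements (λ y → trans (∑-cong (vecs k) (λ ys → 𝟙-∧ (fiber Xs U ys t) _)) (∑-*ʳ (vecs k) _ _)) ⟩
    ∑ elements (λ y → ∑ (vecs k) (λ ys → 𝟙 (fiber Xs U ys t)) * 𝟙 (X (y - t)))
      ≡⟨ ∑-cong elements (λ y → cong (_* 𝟙 (X (y - t))) (∑-fiber Xs U t)) ⟩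
    ∑ elements (λ y → 𝟙 (U t) * ∏card Xs * 𝟙 (X (y - t)))
      ≡⟨ ∑-*ˡ elements (𝟙 (U t) * ∏card Xs) (λ y → 𝟙 (X (y - t))) ⟩
    𝟙 (U t) * ∏card Xs * card (λ y → X (y - t))
      ≡⟨ cong (𝟙 (U t) * ∏card Xs *_) (card-translate X t) ⟩
    𝟙 (U t) * ∏card Xs * card X
      ≡⟨ trans (*-assoc (𝟙 (U t)) _ _) (cong (𝟙 (U t) *_) (*-comm (∏card Xs) (card X))) ⟩
    𝟙 (U t) * ∏card (X ∷ Xs)
      ∎
    where open ≡-Reasoning

  ∑-card-fiber : ∀ {k} (Xs : Vec (G → Bool) k) U → ∑ (vecs k) (λ ys → card (fiber Xs U ys)) ≡ card U * ∏card Xs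
  ∑-card-fiber {k} Xs U =
    trans (∑-comm (vecs k) elements _) (trans (∑-cong elements (∑-fiber Xs U)) (∑-*ʳ elements _ _))

  #image-∷ : ∀ {k} X (Xs : Vec (G → Bool) k) U → #image (X ∷ Xs) U ≡ ∑ (vecs k) (λ ys → card (X ⊕ fiber Xs U ys))
  #image-∷ {k} X Xs U = trans (∑-cartesianProductWith _∷_ elements (vecs k) _) (∑-comm elements (vecs k) _)

  reflect : (G → Bool) → G → Bool
  reflect X x = X (x ⁻¹)

  card-reflect : ∀ X → card (reflect X) ≡ card X
  card-reflect X = card-reindex X _⁻¹ _⁻¹ ⁻¹-involutive ⁻¹-involutive

  fiber⁻ : ∀ {k} (Xs : Vec (G → Bool) k) U ys t → T (fiber Xs U ys t) → ∀ i → T (lookup Xs i (lookup ys i - t))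
  fiber⁻ (X ∷ Xs) U (y ∷ ys) t h zero = proj₂ (T-∧ .Equivalence.to h)
  fiber⁻ (X ∷ Xs) U (y ∷ ys) t h (suc i) = fiber⁻ Xs U ys t (proj₁ (T-∧ .Equivalence.to h)) i

  fiber⁺ : ∀ {k} (Xs : Vec (G → Bool) k) U ys t → T (U t) → (∀ i → T (lookup Xs i (lookup ys i - t))) →
           T (fiber Xs U ys t)
  fiber⁺ [] U [] t Ut _ = Ut
  fiber⁺ (X ∷ Xs) U (y ∷ ys) t Ut h = T-∧ .Equivalence.from (fiber⁺ Xs U ys t Ut (h ∘ suc) , h zero)

  x-[s∙c]≡[x-c]-s : ∀ x s c → x - (s ∙ c) ≡ (x - c) - s
  x-[s∙c]≡[x-c]-s x s c = trans (cong (x ∙_) (⁻¹-anti-homo-∙ s c)) (sym (assoc x (c ⁻¹) (s ⁻¹)))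

  -- Φ maps the image for (Xs′, U′) into the image for (Xs, U); only this inclusion is needed.
  module Exchange {k} (Xs : Vec (G → Bool) k) (U : G → Bool) (j : Fin k) where

    Xs′ : Vec (G → Bool) k
    Xs′ = Xs [ j ]≔ reflect U

    U′ : G → Bool
    U′ = reflect (lookup Xs j)

    Φ : Vec G k → Vec G k
    Φ ys = Vec.map (_- lookup ys j) ys [ j ]≔ lookup ys j ⁻¹

    lookup-Φ-j : ∀ ys → lookup (Φ ys) j ≡ lookup ys j ⁻¹
    lookup-Φ-j ys = lookup∘update j (Vec.map (_- lookup ys j) ys) _

    lookup-Φ : ∀ ys i → i ≢ j → lookup (Φ ys) i ≡ lookup ys i - lookup ys j
    lookup-Φ ys i i≢j = trans (lookup∘update′ i≢j (Vec.map (_- lookup ys j) ys) _) (lookup-map i (_- lookup ys j) ys)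

    Φ-involutive : ∀ ys → Φ (Φ ys) ≡ ys
    Φ-involutive ys = Pointwise-≡⇒≡ (ext lookup-ΦΦ)
      where
      lookup-ΦΦ : ∀ i → lookup (Φ (Φ ys)) i ≡ lookup ys i
      lookup-ΦΦ i with i Fin.≟ j
      ... | yes refl = trans (lookup-Φ-j (Φ ys)) (trans (cong _⁻¹ (lookup-Φ-j ys)) (⁻¹-involutive _))
      ... | no i≢j = begin
        lookup (Φ (Φ ys)) i                              ≡⟨ lookup-Φ (Φ ys) i i≢j ⟩
        lookup (Φ ys) i - lookup (Φ ys) j                ≡⟨ cong₂ _-_ (lookup-Φ ys i i≢j) (lookup-Φ-j ys) ⟩
        (lookup ys i - lookup ys j) - lookup ys j ⁻¹      ≡⟨ cong ((lookup ys i - lookup ys j) ∙_) (⁻¹-involutive _) ⟩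
        (lookup ys i - lookup ys j) ∙ lookup ys j         ≡⟨ [x-y]∙y≡x _ _ ⟩
        lookup ys i                                      ∎
        where open ≡-Reasoning

    image′∘Φ⇒image : ∀ ys → T (image Xs′ U′ (Φ ys)) → T (image Xs U ys)
    image′∘Φ⇒image ys h with some-elim _ h
    ... | t′ , fiber′ = some-intro _ (fiber⁺ Xs U ys (t′ ∙ c) Ut Xs-fits)
      where
      c = lookup ys j
      fits′ = fiber⁻ Xs′ U′ (Φ ys) t′ fiber′
      Ut : T (U (t′ ∙ c))
      Ut = subst (T ∘ U) (trans (cong (λ z → (z - t′) ⁻¹) (lookup-Φ-j ys)) [c⁻¹-t′]⁻¹≡t′∙c)
             (subst (λ Y → T (Y (lookup (Φ ys) j - t′))) (lookup∘update j Xs (reflect U)) (fits′ j))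
        where
        [c⁻¹-t′]⁻¹≡t′∙c : (c ⁻¹ - t′) ⁻¹ ≡ t′ ∙ c
        [c⁻¹-t′]⁻¹≡t′∙c = trans (⁻¹-anti-homo‿- (c ⁻¹) t′) (cong (t′ ∙_) (⁻¹-involutive c))
      Xs-fits : ∀ i → T (lookup Xs i (lookup ys i - (t′ ∙ c)))
      Xs-fits i with i Fin.≟ j
      ... | yes refl = subst (T ∘ lookup Xs i) (sym c-[t′∙c]≡t′⁻¹) (fiber⊆U Xs′ U′ (Φ ys) t′ fiber′)
        where
        c-[t′∙c]≡t′⁻¹ : c - (t′ ∙ c) ≡ t′ ⁻¹
        c-[t′∙c]≡t′⁻¹ = trans (x-[s∙c]≡[x-c]-s c t′ c) (trans (cong (_- t′) (inverseʳ c)) (identityˡ _))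
      ... | no i≢j = subst (T ∘ lookup Xs i) (trans (cong (_- t′) (lookup-Φ ys i i≢j)) (sym (x-[s∙c]≡[x-c]-s _ t′ c)))
                       (subst (λ Y → T (Y (lookup (Φ ys) i - t′))) (lookup∘update′ i≢j Xs (reflect U)) (fits′ i))

    ∏-Exchange : ∀ (f : (G → Bool) → ℕ) → (∀ X → f (reflect X) ≡ f X) →
                 prodV (Vec.map f Xs′) * f U′ ≡ prodV (Vec.map f Xs) * f U
    ∏-Exchange f f-reflect = begin
      prodV (Vec.map f Xs′) * f U′
        ≡⟨ cong₂ (λ v a → prodV v * a) (trans (map-[]≔ f Xs j) (cong (Vec.map f Xs [ j ]≔_) (f-reflect U)))
                                       (trans (f-reflect _) (sym (lookup-map j f Xs))) ⟩
      prodV (Vec.map f Xs [ j ]≔ f U) * lookup (Vec.map f Xs) j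
        ≡⟨ prodV-[]≔ (Vec.map f Xs) j (f U) ⟩
      prodV (Vec.map f Xs) * f U
        ∎
      where open ≡-Reasoning

    #image-Exchange : #image Xs′ U′ ≤ #image Xs U
    #image-Exchange = begin
      #image Xs′ U′                             ≡⟨ sym (Vectors.∑-reindex Φ Φ Φ-involutive Φ-involutive _) ⟩
      ∑ (vecs k) (𝟙 ∘ image Xs′ U′ ∘ Φ)         ≤⟨ ∑-mono (vecs k) (λ ys → 𝟙-mono (image′∘Φ⇒image ys)) ⟩
      #image Xs U                               ∎
      where
      open ≤-Reasoning
      module Vectors = Counting (≡-dec _≟_) (vectors E k)

  module _ (p : ℕ) (order-≥ : ∀ {j d} → 0 < j → j < p → j · d ≡ ε → d ≡ ε) where

    ·-injective-≤ : ∀ {d i j} → d ≢ ε → i ≤ j → j < p → i · d ≡ j · d → i ≡ j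
    ·-injective-≤ {d} {i} d≢ε i≤j j<p id≡jd with m≤n⇒∃[o]m+o≡n i≤j
    ... | zero , refl = sym (+-identityʳ i)
    ... | suc k , refl = ⊥-elim (d≢ε (order-≥ (s≤s z≤n) (≤-<-trans (m≤n+m (suc k) i) j<p) [1+k]d≡ε))
      where
      [1+k]d≡ε : suc k · d ≡ ε
      [1+k]d≡ε = ∙-cancelˡ (i · d) _ _
        (trans (sym (×-homo-+ d i (suc k))) (trans (sym id≡jd) (sym (identityʳ (i · d)))))

    ·-injective : ∀ {d i j} → d ≢ ε → i < p → j < p → i · d ≡ j · d → i ≡ j
    ·-injective {i = i} {j} d≢ε i<p j<p id≡jd with ≤-total i j
    ... | inj₁ i≤j = ·-injective-≤ d≢ε i≤j j<p id≡jd
    ... | inj₂ j≤i = sym (·-injective-≤ d≢ε j≤i i<p (sym id≡jd))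

    orbit : G → G → List G
    orbit a d = map (λ i → a ∙ (toℕ i · d)) (allFin p)

    translation-closed⇒large : ∀ A {a d} → T (A a) → d ≢ ε → (∀ x → T (A x) → T (A (x ∙ d))) → p ≤ card A
    translation-closed⇒large A {a} {d} Aa d≢ε closed = begin
      p                                ≡⟨ sym (trans (length-map _ (allFin p)) (length-tabulate id)) ⟩
      length (orbit a d)               ≡⟨ sym (card-∈ orbit-unique) ⟩
      card (λ x → ⌊ x ∈? orbit a d ⌋) ≤⟨ card-mono orbit⊆A ⟩
      card A                           ∎
      where
      open ≤-Reasoning
      orbit-unique : Unique (orbit a d)
      orbit-unique = Unique.map⁺
        (λ {i} {j} eq → toℕ-injective (·-injective d≢ε (toℕ<n i) (toℕ<n j) (∙-cancelˡ a _ _ eq)))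
        (Unique.allFin⁺ p)
      multiples∈A : ∀ k → T (A (a ∙ (k · d)))
      multiples∈A zero = subst (T ∘ A) (sym (identityʳ a)) Aa
      multiples∈A (suc k) = subst (T ∘ A) (sym (x∙yz≈xz∙y a d (k · d))) (closed _ (multiples∈A k))
      orbit⊆A : ∀ x → T ⌊ x ∈? orbit a d ⌋ → T (A x)
      orbit⊆A x x∈ with ∈-map⁻ _ (toWitness x∈)
      ... | i , _ , refl = multiples∈A (toℕ i)

    cauchy-davenport-≤ : ∀ n {A B} → card B ≤ n → 1 ≤ card A → 1 ≤ card B → card A + card B ≤ suc p →
                         card A + card B ≤ suc (card (A ⊕ B))
    cauchy-davenport-≤ zero B≤0 _ 1≤B _ with ≤-trans 1≤B B≤0
    ... | ()
    cauchy-davenport-≤ (suc n) {A} {B} B≤1+n 1≤A 1≤B A+B≤1+p with nonempty {B} 1≤B | card B ≤? 1 | p ≤? card A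
    ... | b , Bb | yes B≤1 | _ = begin
      card A + card B     ≤⟨ +-monoʳ-≤ (card A) B≤1 ⟩
      card A + 1          ≡⟨ +-comm (card A) 1 ⟩
      suc (card A)        ≤⟨ s≤s (card-≤-⊕ A B Bb) ⟩
      suc (card (A ⊕ B))  ∎
      where open ≤-Reasoning
    ... | b , Bb | no _ | yes p≤A = ≤-trans A+B≤1+p (s≤s (≤-trans p≤A (card-≤-⊕ A B Bb)))
    ... | _ | no B≰1 | no p≰A with two-distinct B (≰⇒> B≰1)
    ...   | b₁ , b₂ , Bb₁ , Bb₂ , b₁≢b₂ with ∃? (λ a → A a ∧ not (A (a ∙ (b₂ - b₁))))
    ...     | inj₂ A-closed with nonempty {A} 1≤A
    ...       | a , Aa = ⊥-elim (p≰A (translation-closed⇒large A Aa d≢ε (λ x → ¬T-∧-not (A-closed x))))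
      where
      d≢ε : b₂ - b₁ ≢ ε
      d≢ε d≡ε = b₁≢b₂ (sym (x∙y⁻¹≈ε⇒x≈y b₂ b₁ d≡ε))
    cauchy-davenport-≤ (suc n) {A} {B} B≤1+n 1≤A 1≤B A+B≤1+p | _ | no _ | no _
      | b₁ , b₂ , Bb₁ , Bb₂ , _ | inj₁ (a , h) = begin
      card A + card B              ≡⟨ sym card-A′+B′ ⟩
      card A′ + card B′            ≤⟨ cauchy-davenport-≤ n B′≤n (≤-trans 1≤A (card-mono A⊆A′))
                                        (card-witness B′ B′b₁) (subst (_≤ suc p) (sym card-A′+B′) A+B≤1+p) ⟩
      suc (card (A′ ⊕ B′))         ≤⟨ s≤s (card-mono A′⊕B′⊆A⊕B) ⟩
      suc (card (A ⊕ B))           ∎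
      where
      open ≤-Reasoning
      open DysonTransform A B (a - b₁)
      B′b₁ : T (B′ b₁)
      B′b₁ = T-∧ .Equivalence.from (Bb₁ , subst (T ∘ A) (sym (y∙[x-y]≡x a b₁)) (proj₁ (T-∧-not h)))
      ¬B′b₂ : ¬ T (B′ b₂)
      ¬B′b₂ B′b₂ = proj₂ (T-∧-not h)
        (subst (T ∘ A) (x∙yz≈y∙xz b₂ a (b₁ ⁻¹)) (proj₂ (T-∧ .Equivalence.to B′b₂)))
      B′≤n : card B′ ≤ n
      B′≤n = s≤s⁻¹ (≤-trans (card-< B′⊆B ¬B′b₂ Bb₂) B≤1+n)

    cauchy-davenport : ∀ {A B} → 1 ≤ card A → 1 ≤ card B → card A + card B ≤ suc p →
                       card A + card B ≤ suc (card (A ⊕ B))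
    cauchy-davenport {B = B} = cauchy-davenport-≤ (card B) ≤-refl

    card-⊕-≥ : ∀ X U F s → card X ≡ suc s → card X + card U ≤ suc p → (∀ t → T (F t) → T (U t)) →
               s * 𝟙 (some F) + card F ≤ card (X ⊕ F)
    card-⊕-≥ X U F s X≡1+s X+U≤1+p F⊆U with some F in someF
    ... | false = subst (_≤ card (X ⊕ F)) (sym (cong₂ _+_ (*-zeroʳ s) (card-none F ¬someF))) z≤n
      where
      ¬someF : ¬ T (some F)
      ¬someF h = subst T someF h
    ... | true with some-elim F (subst T (sym someF) _)
    ...   | t , Ft = s≤s⁻¹ (begin
      suc (s * 1 + card F)  ≡⟨ cong (λ n → suc (n + card F)) (*-identityʳ s) ⟩
      suc s + card F        ≡⟨ cong (_+ card F) (sym X≡1+s) ⟩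
      card X + card F       ≤⟨ cauchy-davenport (subst (1 ≤_) (sym X≡1+s) (s≤s z≤n)) (card-witness F Ft)
                                 (≤-trans (+-monoʳ-≤ (card X) (card-mono F⊆U)) X+U≤1+p) ⟩
      suc (card (X ⊕ F))    ∎)
      where open ≤-Reasoning

    #image-∷-≥ : ∀ {k} X (Xs : Vec (G → Bool) k) U s → card X ≡ suc s → card X + card U ≤ suc p →
                 s * #image Xs U + card U * ∏card Xs ≤ #image (X ∷ Xs) U
    #image-∷-≥ {k} X Xs U s X≡1+s X+U≤1+p = begin
      s * #image Xs U + card U * ∏card Xs
        ≡⟨ cong₂ _+_ (sym (∑-*ˡ (vecs k) s _)) (sym (∑-card-fiber Xs U)) ⟩
      ∑ (vecs k) (λ ys → s * 𝟙 (image Xs U ys)) + ∑ (vecs k) (λ ys → card (fiber Xs U ys))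
        ≡⟨ sym (∑-distrib-+ (vecs k) _ _) ⟩
      ∑ (vecs k) (λ ys → s * 𝟙 (image Xs U ys) + card (fiber Xs U ys))
        ≤⟨ ∑-mono (vecs k) (λ ys → card-⊕-≥ X U (fiber Xs U ys) s X≡1+s X+U≤1+p (fiber⊆U Xs U ys)) ⟩
      ∑ (vecs k) (λ ys → card (X ⊕ fiber Xs U ys))
        ≡⟨ sym (#image-∷ X Xs U) ⟩
      #image (X ∷ Xs) U
        ∎
      where open ≤-Reasoning

    #image-≥ : ∀ {k} (Xs : Vec (G → Bool) k) U → 1 ≤ card U →
               (∀ i → 1 ≤ card (lookup Xs i) × card (lookup Xs i) + card U ≤ suc p) →
               ∏card Xs * card U ≤ #image Xs U + ∏card⁻ Xs * pred (card U)
    #image-≥ [] U 1≤U _ with nonempty {U} 1≤U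
    ... | u , Uu = ≤-reflexive (begin
      1 * card U                        ≡⟨ *-identityˡ (card U) ⟩
      card U                            ≡⟨ sym (suc-pred (card U) {{>-nonZero 1≤U}}) ⟩
      1 + pred (card U)                 ≡⟨ cong₂ _+_ (sym #image[]≡1) (sym (*-identityˡ _)) ⟩
      #image [] U + 1 * pred (card U)   ∎)
      where
      open ≡-Reasoning
      #image[]≡1 : #image [] U ≡ 1
      #image[]≡1 = cong (λ b → 𝟙 b + 0) (T-≡ .Equivalence.to (some-intro U Uu))
    #image-≥ (X ∷ Xs) U 1≤U bounds =
      subst (λ x → x * P * u ≤ #image (X ∷ Xs) U + pred x * Q * pred u) X≡1+s (begin
        suc s * P * u                    ≡⟨ expand s P u ⟩
        u * P + s * (P * u)              ≤⟨ +-monoʳ-≤ (u * P) (*-monoʳ-≤ s (#image-≥ Xs U 1≤U (bounds ∘ suc))) ⟩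
        u * P + s * (N + Q * pred u)     ≡⟨ regroup s N Q (pred u) (u * P) ⟩
        (s * N + u * P) + s * Q * pred u ≤⟨ +-monoˡ-≤ _ (#image-∷-≥ X Xs U s (sym X≡1+s) X+U≤1+p) ⟩
        #image (X ∷ Xs) U + s * Q * pred u ∎)
      where
      open ≤-Reasoning
      1≤X = proj₁ (bounds zero)
      X+U≤1+p = proj₂ (bounds zero)
      s = pred (card X)
      X≡1+s : suc s ≡ card X
      X≡1+s = suc-pred (card X) {{>-nonZero 1≤X}}
      P = ∏card Xs
      Q = ∏card⁻ Xs
      u = card U
      N = #image Xs U
      expand : ∀ s P u → suc s * P * u ≡ u * P + s * (P * u)
      expand = solve-∀
      regroup : ∀ s N Q u′ uP → uP + s * (N + Q * u′) ≡ (s * N + uP) + s * Q * u′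
      regroup = solve-∀

    #image-≥-via-exchange : ∀ {k} (Xs : Vec (G → Bool) k) U j → 1 ≤ card U → (∀ i → 1 ≤ card (lookup Xs i)) →
                            card (lookup Xs j) + card U ≤ suc p →
                            (∀ i → card (lookup Xs j) + card (lookup Xs i) ≤ suc p) →
                            ∏card Xs * card U ≤ #image Xs U + ∏card⁻ Xs * pred (card U)
    #image-≥-via-exchange Xs U j 1≤U 1≤Xs Xⱼ+U≤1+p Xⱼ+Xs≤1+p = begin
      ∏card Xs * card U
        ≡⟨ sym (∏-Exchange card card-reflect) ⟩
      ∏card Xs′ * card U′
        ≤⟨ #image-≥ Xs′ U′ 1≤U′ bounds′ ⟩
      #image Xs′ U′ + ∏card⁻ Xs′ * pred (card U′)
        ≤⟨ +-mono-≤ #image-Exchange (≤-reflexive (∏-Exchange (pred ∘ card) (cong pred ∘ card-reflect))) ⟩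
      #image Xs U + ∏card⁻ Xs * pred (card U)
        ∎
      where
      open ≤-Reasoning
      open Exchange Xs U j
      U′≡Xⱼ : card U′ ≡ card (lookup Xs j)
      U′≡Xⱼ = card-reflect (lookup Xs j)
      1≤U′ : 1 ≤ card U′
      1≤U′ = subst (1 ≤_) (sym U′≡Xⱼ) (1≤Xs j)
      bounds′ : ∀ i → 1 ≤ card (lookup Xs′ i) × card (lookup Xs′ i) + card U′ ≤ suc p
      bounds′ i with i Fin.≟ j
      ... | yes refl rewrite lookup∘update i Xs (reflect U) | card-reflect U | U′≡Xⱼ =
        1≤U , subst (_≤ suc p) (+-comm (card (lookup Xs i)) (card U)) Xⱼ+U≤1+p
      ... | no i≢j rewrite lookup∘update′ i≢j Xs (reflect U) | U′≡Xⱼ =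
        1≤Xs i , subst (_≤ suc p) (+-comm (card (lookup Xs j)) _) (Xⱼ+Xs≤1+p i)

    #image-≥-init-last : ∀ {k} (Ss : Vec (G → Bool) (suc k)) → (∀ i → 1 ≤ card (lookup Ss i)) →
                         ∀ j → (∀ i → card (lookup Ss j) + card (lookup Ss i) ≤ suc p) →
                         prodV (Vec.map card Ss) ≤ #image (init Ss) (last Ss) + prodV (Vec.map (pred ∘ card) Ss)
    #image-≥-init-last {k} Ss 1≤Ss j Sⱼ+Ss≤1+p =
      subst₂ _≤_ (sym (prodV-map-init-last card Ss))
                 (cong (#image Xs U +_) (sym (prodV-map-init-last (pred ∘ card) Ss)))
                 (by-pivot (lookup-init-last Ss j))
      where
      Xs = init Ss
      U = last Ss
      1≤U : 1 ≤ card U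
      1≤U = subst (1 ≤_) (cong card (sym (lookup-last Ss))) (1≤Ss (fromℕ k))
      1≤Xs : ∀ i → 1 ≤ card (lookup Xs i)
      1≤Xs i = subst (1 ≤_) (cong card (sym (lookup-init Ss i))) (1≤Ss (inject₁ i))
      Sⱼ+U≤1+p : card (lookup Ss j) + card U ≤ suc p
      Sⱼ+U≤1+p = subst (λ S → card (lookup Ss j) + card S ≤ suc p) (sym (lookup-last Ss)) (Sⱼ+Ss≤1+p (fromℕ k))
      Sⱼ+Xs≤1+p : ∀ i → card (lookup Ss j) + card (lookup Xs i) ≤ suc p
      Sⱼ+Xs≤1+p i = subst (λ S → card (lookup Ss j) + card S ≤ suc p) (sym (lookup-init Ss i)) (Sⱼ+Ss≤1+p (inject₁ i))
      by-pivot : lookup Ss j ≡ U ⊎ ∃ (λ j′ → lookup Ss j ≡ lookup Xs j′) →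
                 ∏card Xs * card U ≤ #image Xs U + ∏card⁻ Xs * pred (card U)
      by-pivot (inj₁ Sⱼ≡U) = #image-≥ Xs U 1≤U λ i →
        1≤Xs i , subst (λ S → card (lookup Xs i) + card S ≤ suc p) Sⱼ≡U
                   (subst (_≤ suc p) (+-comm (card (lookup Ss j)) _) (Sⱼ+Xs≤1+p i))
      by-pivot (inj₂ (j′ , Sⱼ≡Xⱼ′)) = #image-≥-via-exchange Xs U j′ 1≤U 1≤Xs
        (subst (λ S → card S + card U ≤ suc p) Sⱼ≡Xⱼ′ Sⱼ+U≤1+p)
        (λ i → subst (λ S → card S + card (lookup Xs i) ≤ suc p) Sⱼ≡Xⱼ′ (Sⱼ+Xs≤1+p i))

-- The group ℤ/pℤ and the theorem

module _ (p : ℕ) .{{_ : NonZero p}} where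

  0ₚ : Fin p
  0ₚ = 0 mod p

  -ₚ_ : Fin p → Fin p
  -ₚ a = (p ∸ toℕ a) mod p

  toℕ-mod : ∀ m → toℕ (m mod p) ≡ m % p
  toℕ-mod m = toℕ-fromℕ< _

  mod-toℕ : ∀ a → toℕ a mod p ≡ a
  mod-toℕ a = toℕ-injective (trans (toℕ-mod (toℕ a)) (m<n⇒m%n≡m (toℕ<n a)))

  mod-cong : ∀ {m n} → m % p ≡ n % p → m mod p ≡ n mod p
  mod-cong {m} {n} eq = toℕ-injective (trans (toℕ-mod m) (trans eq (sym (toℕ-mod n))))

  mod-+ : ∀ m n → (m mod p) +ₚ (n mod p) ≡ (m + n) mod p
  mod-+ m n = mod-cong (begin
    (toℕ (m mod p) + toℕ (n mod p)) % p  ≡⟨ cong₂ (λ a b → (a + b) % p) (toℕ-mod m) (toℕ-mod n) ⟩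
    (m % p + n % p) % p                  ≡⟨ sym (%-distribˡ-+ m n p) ⟩
    (m + n) % p                          ∎)
    where open ≡-Reasoning

  +ₚ-comm : ∀ a b → a +ₚ b ≡ b +ₚ a
  +ₚ-comm a b = cong (_mod p) (+-comm (toℕ a) (toℕ b))

  +ₚ-assoc : ∀ a b c → (a +ₚ b) +ₚ c ≡ a +ₚ (b +ₚ c)
  +ₚ-assoc a b c = begin
    (a +ₚ b) +ₚ c                                 ≡⟨ cong ((a +ₚ b) +ₚ_) (sym (mod-toℕ c)) ⟩
    ((toℕ a + toℕ b) mod p) +ₚ (toℕ c mod p)      ≡⟨ mod-+ (toℕ a + toℕ b) (toℕ c) ⟩
    (toℕ a + toℕ b + toℕ c) mod p                 ≡⟨ cong (_mod p) (+-assoc (toℕ a) (toℕ b) (toℕ c)) ⟩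
    (toℕ a + (toℕ b + toℕ c)) mod p               ≡⟨ sym (mod-+ (toℕ a) (toℕ b + toℕ c)) ⟩
    (toℕ a mod p) +ₚ ((toℕ b + toℕ c) mod p)      ≡⟨ cong (_+ₚ (b +ₚ c)) (mod-toℕ a) ⟩
    a +ₚ (b +ₚ c)                                 ∎
    where open ≡-Reasoning

  +ₚ-identityˡ : ∀ a → 0ₚ +ₚ a ≡ a
  +ₚ-identityˡ a = trans (cong (0ₚ +ₚ_) (sym (mod-toℕ a))) (trans (mod-+ 0 (toℕ a)) (mod-toℕ a))

  +ₚ-inverseˡ : ∀ a → (-ₚ a) +ₚ a ≡ 0ₚ
  +ₚ-inverseˡ a = begin
    (-ₚ a) +ₚ a                             ≡⟨ cong ((-ₚ a) +ₚ_) (sym (mod-toℕ a)) ⟩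
    ((p ∸ toℕ a) mod p) +ₚ (toℕ a mod p)    ≡⟨ mod-+ (p ∸ toℕ a) (toℕ a) ⟩
    (p ∸ toℕ a + toℕ a) mod p               ≡⟨ cong (_mod p) (m∸n+n≡m (<⇒≤ (toℕ<n a))) ⟩
    p mod p                                 ≡⟨ mod-cong (trans (n%n≡0 p) (sym (m<n⇒m%n≡m (>-nonZero⁻¹ p)))) ⟩
    0ₚ                                      ∎
    where open ≡-Reasoning

  +ₚ-isAbelianGroup : IsAbelianGroup _≡_ _+ₚ_ 0ₚ -ₚ_
  +ₚ-isAbelianGroup = record
    { isGroup = record
      { isMonoid = record
        { isSemigroup = record
          { isMagma = record { isEquivalence = isEquivalence ; ∙-cong = cong₂ _+ₚ_ }
          ; assoc = +ₚ-assoc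
          }
        ; identity = +ₚ-identityˡ , λ a → trans (+ₚ-comm a 0ₚ) (+ₚ-identityˡ a)
        }
      ; inverse = +ₚ-inverseˡ , λ a → trans (+ₚ-comm a (-ₚ a)) (+ₚ-inverseˡ a)
      ; ⁻¹-cong = cong -ₚ_
      }
    ; comm = +ₚ-comm
    }

  open Sumsets +ₚ-isAbelianGroup Fin._≟_ (allFin-enumeration p)
  open MonoidMultiplication (AbelianGroup.monoid abelianGroup) using () renaming (_×_ to _·_)

  ·-mod : ∀ j m → j · (m mod p) ≡ (j * m) mod p
  ·-mod zero m = refl
  ·-mod (suc j) m = trans (cong ((m mod p) +ₚ_) (·-mod j m)) (mod-+ m (j * m))

  toℕ-0ₚ : toℕ 0ₚ ≡ 0
  toℕ-0ₚ = trans (toℕ-mod 0) (m<n⇒m%n≡m (>-nonZero⁻¹ p))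

  ∣∧<⇒≡0 : ∀ {m} → p ∣ m → m < p → m ≡ 0
  ∣∧<⇒≡0 {m} p∣m m<p = trans (sym (m<n⇒m%n≡m m<p)) (n∣m⇒m%n≡0 m p p∣m)

  ·≡0ₚ⇒∣ : ∀ j d → j · d ≡ 0ₚ → p ∣ j * toℕ d
  ·≡0ₚ⇒∣ j d jd≡0 = m%n≡0⇒n∣m _ p (begin
    (j * toℕ d) % p           ≡⟨ sym (toℕ-mod (j * toℕ d)) ⟩
    toℕ ((j * toℕ d) mod p)   ≡⟨ cong toℕ (trans (sym (·-mod j (toℕ d))) (trans (cong (j ·_) (mod-toℕ d)) jd≡0)) ⟩
    toℕ 0ₚ                    ≡⟨ toℕ-0ₚ ⟩
    0                         ∎)
    where open ≡-Reasoning

  prime⇒order-≥ : Prime p → ∀ {j d} → 0 < j → j < p → j · d ≡ 0ₚ → d ≡ 0ₚ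
  prime⇒order-≥ p-prime {j} {d} 0<j j<p jd≡0 with euclidsLemma j (toℕ d) p-prime (·≡0ₚ⇒∣ j d jd≡0)
  ... | inj₁ p∣j = ⊥-elim (<⇒≢ 0<j (sym (∣∧<⇒≡0 p∣j j<p)))
  ... | inj₂ p∣d = toℕ-injective (trans (∣∧<⇒≡0 p∣d (toℕ<n d)) (sym toℕ-0ₚ))

  card-lookup : ∀ (X : Subset p) → card (lookup X) ≡ ∣ X ∣
  card-lookup = ∑-lookup-allFin
    where
    ∑-lookup-allFin : ∀ {n} (X : Subset n) → ∑ (allFin n) (𝟙 ∘ lookup X) ≡ ∣ X ∣
    ∑-lookup-allFin [] = refl
    ∑-lookup-allFin (true ∷ X) = trans (∑-allFin-suc (𝟙 ∘ lookup (true ∷ X))) (cong suc (∑-lookup-allFin X))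
    ∑-lookup-allFin (false ∷ X) = trans (∑-allFin-suc (𝟙 ∘ lookup (false ∷ X))) (∑-lookup-allFin X)

  ∈-elems⁺ : ∀ (X : Subset p) {x} → T (lookup X x) → x ∈ elems X
  ∈-elems⁺ X {x} Xx = ∈-filter⁺ (_∈ₛ? X) (∈-allFin x) (lookup⇒[]= x X (T-≡ .Equivalence.to Xx))

  ∈-elems⁻ : ∀ (X : Subset p) {x} → x ∈ elems X → T (lookup X x)
  ∈-elems⁻ X x∈ = T-≡ .Equivalence.from ([]=⇒lookup (proj₂ (∈-filter⁻ (_∈ₛ? X) {xs = allFin p} x∈)))

  choice⇒fiber : ∀ {m} (S : Vec (Subset p) (suc m)) {x} → x ∈ choices S →
                 T (fiber (init (Vec.map lookup S)) (last (Vec.map lookup S)) (L x) (last x))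
  choice⇒fiber (X ∷ []) x∈ with ∈-cartesianProductWith⁻ _∷_ (elems X) (choices []) x∈
  ... | a , [] , a∈X , _ , refl = ∈-elems⁻ X a∈X
  choice⇒fiber (X ∷ S@(_ ∷ _)) x∈ with ∈-cartesianProductWith⁻ _∷_ (elems X) (choices S) x∈
  ... | a , x , a∈X , x∈S , refl = T-∧ .Equivalence.from
        (choice⇒fiber S x∈S , subst (T ∘ lookup X) (sym ([x∙y]-y≡x a (last x))) (∈-elems⁻ X a∈X))

  fiber⇒choice : ∀ {m} (S : Vec (Subset p) (suc m)) y t →
                 T (fiber (init (Vec.map lookup S)) (last (Vec.map lookup S)) y t) →
                 ∃ λ x → x ∈ choices S × L x ≡ y × last x ≡ t
  fiber⇒choice (X ∷ []) [] t Xt = (t ∷ []) , ∈-cartesianProductWith⁺ _∷_ (∈-elems⁺ X Xt) (here refl) , refl , refl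
  fiber⇒choice (X ∷ S@(_ ∷ _)) (b ∷ y) t h with T-∧ .Equivalence.to h
  ... | h′ , X[b-t] with fiber⇒choice S y t h′
  ...   | x , x∈S , refl , refl = ((b - t) ∷ x) , ∈-cartesianProductWith⁺ _∷_ (∈-elems⁺ X X[b-t]) x∈S
                                  , cong (_∷ L x) ([x-y]∙y≡x b (last x)) , refl

  imageSize≡#image : ∀ {m} (S : Vec (Subset p) (suc m)) →
                     imageSize S ≡ #image (init (Vec.map lookup S)) (last (Vec.map lookup S))
  imageSize≡#image {m} S = begin
    imageSize S                              ≡⟨ sym (Vectors.card-∈ (deduplicate-! (≡-dec Fin._≟_) images)) ⟩
    Vectors.card (λ y → ⌊ y ∈? distinct ⌋)   ≡⟨ ∑-cong (vecs m) (cong 𝟙 ∘ ∈?≡image) ⟩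
    #image Xs U                              ∎
    where
    open ≡-Reasoning
    module Vectors = Counting (≡-dec Fin._≟_) (vectors (allFin-enumeration p) m)
    open import Data.List.Membership.DecPropositional (≡-dec (Fin._≟_ {p})) using (_∈?_)
    Xs = init (Vec.map lookup S)
    U = last (Vec.map lookup S)
    images = List.map L (choices S)
    distinct = deduplicate (≡-dec Fin._≟_) images
    ∈?≡image : ∀ y → ⌊ y ∈? distinct ⌋ ≡ image Xs U y
    ∈?≡image y = T-ext ⇒image image⇒
      where
      ⇒image : T ⌊ y ∈? distinct ⌋ → T (image Xs U y)
      ⇒image y∈ with ∈-map⁻ L (∈-deduplicate⁻ (≡-dec Fin._≟_) images (toWitness y∈))
      ... | x , x∈S , refl = some-intro (fiber Xs U (L x)) (choice⇒fiber S x∈S)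
      image⇒ : T (image Xs U y) → T ⌊ y ∈? distinct ⌋
      image⇒ h with some-elim _ h
      ... | t , fiber-t with fiber⇒choice S y t fiber-t
      ...   | x , x∈S , refl , _ = fromWitness (∈-deduplicate⁺ (≡-dec Fin._≟_) (∈-map⁺ L x∈S))

  imageSize-≥ : Prime p → ∀ {m} (S : Vec (Subset p) (suc m)) → (∀ i → 1 ≤ ∣ lookup S i ∣) →
                ∀ j → (∀ i → ∣ lookup S j ∣ + ∣ lookup S i ∣ ≤ suc p) →
                prodV (Vec.map ∣_∣ S) ≤ imageSize S + prodV (Vec.map (λ T → pred ∣ T ∣) S)
  imageSize-≥ p-prime S 1≤S j Sⱼ+S≤1+p = begin
    prodV (Vec.map ∣_∣ S)
      ≡⟨ cong prodV (sym (map∘lookup card-lookup)) ⟩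
    prodV (Vec.map card Ss)
      ≤⟨ #image-≥-init-last p (prime⇒order-≥ p-prime) Ss 1≤Ss j Ssⱼ+Ss≤1+p ⟩
    #image (init Ss) (last Ss) + prodV (Vec.map (pred ∘ card) Ss)
      ≡⟨ cong₂ _+_ (sym (imageSize≡#image S)) (cong prodV (map∘lookup (cong pred ∘ card-lookup))) ⟩
    imageSize S + prodV (Vec.map (λ T → pred ∣ T ∣) S)
      ∎
    where
    open ≤-Reasoning
    Ss = Vec.map lookup S
    map∘lookup : ∀ {f : (Fin p → Bool) → ℕ} {g : Subset p → ℕ} → (∀ T → f (lookup T) ≡ g T) →
                 Vec.map f Ss ≡ Vec.map g S
    map∘lookup f∘lookup≗g = trans (sym (VecProperties.map-∘ _ lookup S)) (VecProperties.map-cong f∘lookup≗g S)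
    card-Ssᵢ : ∀ i → card (lookup Ss i) ≡ ∣ lookup S i ∣
    card-Ssᵢ i = trans (cong card (lookup-map i lookup S)) (card-lookup (lookup S i))
    1≤Ss : ∀ i → 1 ≤ card (lookup Ss i)
    1≤Ss i = subst (1 ≤_) (sym (card-Ssᵢ i)) (1≤S i)
    Ssⱼ+Ss≤1+p : ∀ i → card (lookup Ss j) + card (lookup Ss i) ≤ suc p
    Ssⱼ+Ss≤1+p i = subst₂ (λ a b → a + b ≤ suc p) (sym (card-Ssᵢ j)) (sym (card-Ssᵢ i)) (Sⱼ+S≤1+p i)

lemma1 : (p : ℕ) .{{_ : NonZero p}} → Prime p →
         (m : ℕ) → 1 ≤ m →
         (S : Vec (Subset p) (suc m)) →
         (∀ i → ∣ lookup S i ∣ ≥ 1) →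
         foldr₁ _⊓_ (Vec.map ∣_∣ S) + foldr₁ _⊔_ (Vec.map ∣_∣ S) ≤ p + 1 →
         imageSize S ≥ prodV (Vec.map ∣_∣ S) ∸ prodV (Vec.map (λ T → pred ∣ T ∣) S)
lemma1 p p-prime m _ S 1≤S min+max≤p+1 =
  m≤n+o⇒m∸n≤o _ _ (subst (prodV sizes ≤_) (+-comm (imageSize S) _)
    (imageSize-≥ p p-prime S 1≤S j smallest+Sᵢ≤1+p))
  where
  sizes = Vec.map ∣_∣ S
  j = proj₁ (foldr₁-⊓-attained sizes)
  smallest+Sᵢ≤1+p : ∀ i → ∣ lookup S j ∣ + ∣ lookup S i ∣ ≤ suc p
  smallest+Sᵢ≤1+p i = begin
    ∣ lookup S j ∣ + ∣ lookup S i ∣       ≡⟨ cong₂ _+_ (sym (lookup-map j ∣_∣ S)) (sym (lookup-map i ∣_∣ S)) ⟩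
    lookup sizes j + lookup sizes i      ≤⟨ +-mono-≤ (≤-reflexive (proj₂ (foldr₁-⊓-attained sizes)))
                                                     (≤-foldr₁-⊔ sizes i) ⟩
    foldr₁ _⊓_ sizes + foldr₁ _⊔_ sizes  ≤⟨ min+max≤p+1 ⟩
    p + 1                                ≡⟨ +-comm p 1 ⟩
    suc p                                ∎
    where open ≤-Reasoning
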